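{- Let $n \geq 2$ and let $G$ be a finite simple graph on $n$ vertices. For $i = 0, 1, \ldots, n-1$ define the vector $\mathbf{x}_i \in \mathbb{R}^n$ by: $\mathbf{x}_0 = (1,1,\ldots,1)^T$, and for $1 \leq i \leq n-1$, the $j$-th entry of $\mathbf{x}_i$ is $-1$ if $1 \leq j \leq i$, is $i$ if $j = i+1$, and is $0$ if $j \geq i+2$. Then there exists a labelling $v_1, v_2, \ldots, v_n$ of the vertex set of $G$ such that every vector $\mathbf{x}_0, \mathbf{x}_1, \ldots, \mathbf{x}_{n-1}$ is an eigenvector of the Laplacian matrix $L(G)$ (written with respect to this labelling) if and only if $G$ is a threshold graph.
   Context: The Laplacian matrix of $G$ with respect to a labelling $v_1,\ldots,v_n$ is $L(G) = D(G) - A(G)$, where $A(G)$ is the adjacency matrix ($A_{ij}=1$ if $v_i, v_j$ are adjacent and $0$ otherwise) and $D(G)$ is the diagonal matrix with $D_{ii}$ equal to the degree of $v_i$. A threshold graph is a graph that can be constructed starting from a single isolated vertex by successively adding vertices, each new vertex being either an isolated vertex (adjacent to none of the previous vertices) or a dominating vertex (adjacent to all previous vertices); equivalently, a graph containing no induced subgraph isomorphic to $P_4$, $C_4$, or $2K_2$. -}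

module Defs where

open import Data.Nat using (ℕ; zero; suc)
open import Data.Fin using (Fin; zero; suc; toℕ; _<_)
open import Data.Bool using (Bool; true; false; if_then_else_)
open import Data.Integer using (ℤ; +_; -_; _+_; _*_; 0ℤ; 1ℤ; -1ℤ; _-_)
open import Data.Product using (Σ; ∃; ∃-syntax; _×_)
open import Data.Sum using (_⊎_)
open import Function.Bundles using (_⇔_)
open import Data.Fin.Permutation using (Permutation′; _⟨$⟩ʳ_)
open import Relation.Binary.PropositionalEquality using (_≡_; _≢_)
open import Relation.Nullary using (Dec; yes; no)
open import Relation.Nullary.Decidable using (⌊_⌋)
open import Data.Nat using (_≟_)
open import Data.Fin using () renaming (_≟_ to _≟ᶠ_)
open import Data.Nat using () renaming (_<?_ to _<ℕ?_)

record SimpleGraph (n : ℕ) : Set where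
  field
    adj    : Fin n → Fin n → Bool
    sym    : ∀ i j → adj i j ≡ adj j i
    irrefl : ∀ i → adj i i ≡ false
open SimpleGraph public

∑ : ∀ {n} → (Fin n → ℤ) → ℤ
∑ {zero}  f = 0ℤ
∑ {suc n} f = f zero + ∑ (λ i → f (suc i))

b2ℤ : Bool → ℤ
b2ℤ true  = 1ℤ
b2ℤ false = 0ℤ

Matrix : ℕ → Set
Matrix n = Fin n → Fin n → ℤ

Vector : ℕ → Set
Vector n = Fin n → ℤ

adjMatrix : ∀ {n} → SimpleGraph n → Permutation′ n → Matrix n
adjMatrix G σ i j = b2ℤ (adj G (σ ⟨$⟩ʳ i) (σ ⟨$⟩ʳ j))

degree : ∀ {n} → SimpleGraph n → Fin n → ℤ
degree G v = ∑ (λ w → b2ℤ (adj G v w))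

degMatrix : ∀ {n} → SimpleGraph n → Permutation′ n → Matrix n
degMatrix G σ i j with i ≟ᶠ j
... | yes _ = degree G (σ ⟨$⟩ʳ i)
... | no  _ = 0ℤ

laplacian : ∀ {n} → SimpleGraph n → Permutation′ n → Matrix n
laplacian G σ i j = degMatrix G σ i j - adjMatrix G σ i j

_·_ : ∀ {n} → Matrix n → Vector n → Vector n
(M · x) i = ∑ (λ j → M i j * x j)

IsEigenvector : ∀ {n} → Matrix n → Vector n → Set
IsEigenvector M x = (∃[ k ] x k ≢ 0ℤ) × (∃[ λ' ] (∀ k → (M · x) k ≡ λ' * x k))

-- The vectors x_0,...,x_{n-1} (0-based entry index k; paper's j = k+1).
-- x_0 = all ones; for i ≥ 1: entry -1 if k < i, i if k = i, 0 if k > i.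
xvec : ∀ {n} → Fin n → Vector n
xvec zero k = 1ℤ
xvec (suc i) k with toℕ k <ℕ? toℕ (suc i) | toℕ k ≟ toℕ (suc i)
... | yes _ | _     = -1ℤ
... | no _  | yes _ = + toℕ (suc i)
... | no _  | no _  = 0ℤ

-- Threshold graph: G is isomorphic to a graph built from a single vertex by
-- successively adding isolated/dominating vertices. The built graph on
-- 0,1,...,n-1 with choice s k (true = dominating) when vertex k is added
-- (s 0 irrelevant) has i,j adjacent iff (i < j and s j) or (j < i and s i).
-- σ maps construction order to vertices of G.
IsThreshold : ∀ {n} → SimpleGraph n → Set
IsThreshold {n} G =
  Σ (Permutation′ n) λ σ → Σ (Fin n → Bool) λ s → (∀ (i j : Fin n) →
    (adj G (σ ⟨$⟩ʳ i) (σ ⟨$⟩ʳ j) ≡ true) ⇔ ((i < j × s j ≡ true) ⊎ (j < i × s i ≡ true)))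

-- Row v of L x is the sum of x_v − x_j over the neighbours j of v. For x = x_M the
-- differences are x_v + 1 at the vertices before M, x_v − M at M and x_v after M.
-- If vertex k of a threshold labelling is dominating iff s k, a vertex after M is adjacent
-- to all or none of the vertices up to M, so its row vanishes, and the rows up to M yield
-- the eigenvalue (M + 1)[s M] + #{k > M : s k}. Conversely x_M vanishes after M, so for
-- v > M the row equation says that v has exactly M·[v ~ M] neighbours before M: v is
-- adjacent to all of them or to none. Letting M range over 1, 2, … shows that every vertex
-- is adjacent either to all earlier vertices or to none, as its adjacency to the first
-- vertex dictates; this is a threshold labelling.
module Submission where

open import Defs
open import Data.Bool using (Bool; true; false; if_then_else_)
open import Data.Bool.Properties using (⇔→≡)
open import Data.Fin as F using (Fin; zero; suc; toℕ)
import Data.Fin.Properties as FP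
open import Data.Fin.Permutation using (Permutation′; _⟨$⟩ʳ_)
open import Data.Integer using (ℤ; +_; _+_; _*_; 0ℤ; 1ℤ; -1ℤ; _-_)
import Data.Integer.Properties as ℤP
open import Data.Integer.Tactic.RingSolver using (solve-∀)
open import Data.Nat as ℕ using (ℕ; zero; suc; _≤_; _∸_; z≤n; s≤s)
import Data.Nat.Properties as ℕP
open import Data.Product using (Σ; _,_; _×_)
open import Data.Product.Function.NonDependent.Propositional using (_×-⇔_)
open import Data.Sum using (_⊎_; inj₁; inj₂)
open import Data.Sum.Function.Propositional using (_⊎-⇔_)
open import Function using (_∘_)
open import Function.Bundles using (_⇔_; mk⇔; Equivalence)
import Function.Properties.Equivalence as ⇔
open import Relation.Binary using (tri<; tri≈; tri>)
open import Relation.Binary.PropositionalEquality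
  using (_≡_; _≢_; refl; trans; cong; cong₂; module ≡-Reasoning)
import Relation.Binary.PropositionalEquality as ≡
open import Relation.Nullary using (yes; no; contradiction)
import Algebra.Properties.CommutativeMonoid.Sum as MonoidSum
open import Algebra.Properties.Ring ℤP.+-*-ring using (x[y-z]≈xy-xz; [y-z]x≈yx-zx)

open ≡-Reasoning

-- Finite sums

∑-cong : ∀ {n} {f g : Fin n → ℤ} → (∀ j → f j ≡ g j) → ∑ f ≡ ∑ g
∑-cong {zero}  f≗g = refl
∑-cong {suc n} f≗g = cong₂ _+_ (f≗g zero) (∑-cong (f≗g ∘ suc))

∑-sub : ∀ {n} (f g : Fin n → ℤ) → ∑ (λ j → f j - g j) ≡ ∑ f - ∑ g
∑-sub {zero}  f g = refl
∑-sub {suc n} f g = begin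
  (f zero - g zero) + ∑ (λ j → f (suc j) - g (suc j))
    ≡⟨ cong (λ y → (f zero - g zero) + y) (∑-sub (f ∘ suc) (g ∘ suc)) ⟩
  (f zero - g zero) + (∑ (f ∘ suc) - ∑ (g ∘ suc))
    ≡⟨ interchange (f zero) (g zero) (∑ (f ∘ suc)) (∑ (g ∘ suc)) ⟩
  (f zero + ∑ (f ∘ suc)) - (g zero + ∑ (g ∘ suc)) ∎
  where
  interchange : ∀ a b c d → (a - b) + (c - d) ≡ (a + c) - (b + d)
  interchange = solve-∀

∑-*ʳ : ∀ {n} (f : Fin n → ℤ) c → ∑ (λ j → f j * c) ≡ ∑ f * c
∑-*ʳ {zero}  f c = ≡.sym (ℤP.*-zeroˡ c)
∑-*ʳ {suc n} f c = trans (cong (λ y → f zero * c + y) (∑-*ʳ (f ∘ suc) c))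
                         (≡.sym (ℤP.*-distribʳ-+ c (f zero) (∑ (f ∘ suc))))

∑-single : ∀ {n} (f : Fin n → ℤ) v → (∀ j → j ≢ v → f j ≡ 0ℤ) → ∑ f ≡ f v
∑-single {suc n} f zero    f≡0 =
  trans (cong (λ y → f zero + y) (trans (∑-cong (λ j → f≡0 (suc j) λ ())) (∑-zero n)))
        (ℤP.+-identityʳ (f zero))
  where
  ∑-zero : ∀ m → ∑ {m} (λ _ → 0ℤ) ≡ 0ℤ
  ∑-zero zero    = refl
  ∑-zero (suc m) = trans (ℤP.+-identityˡ _) (∑-zero m)
∑-single {suc n} f (suc v) f≡0 =
  trans (cong₂ _+_ (f≡0 zero λ ()) (∑-single (f ∘ suc) v λ j j≢v → f≡0 (suc j) (j≢v ∘ FP.suc-injective)))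
        (ℤP.+-identityˡ (f (suc v)))

∑-permute : ∀ {n} (f : Fin n → ℤ) (π : Permutation′ n) → ∑ f ≡ ∑ (λ j → f (π ⟨$⟩ʳ j))
∑-permute f π = trans (≡.sym (sum≡∑ f)) (trans (Sum.∑-permute f π) (sum≡∑ (f ∘ (π ⟨$⟩ʳ_))))
  where
  module Sum = MonoidSum ℤP.+-0-commutativeMonoid
  sum≡∑ : ∀ {n} (f : Fin n → ℤ) → Sum.sum f ≡ ∑ f
  sum≡∑ {zero}  f = refl
  sum≡∑ {suc n} f = cong (λ y → f zero + y) (sum≡∑ (f ∘ suc))

∑ℕ : ℕ → (ℕ → ℤ) → ℤ
∑ℕ zero    f = 0ℤ
∑ℕ (suc n) f = f 0 + ∑ℕ n (f ∘ suc)

∑-toℕ : ∀ n (f : ℕ → ℤ) → ∑ {n} (f ∘ toℕ) ≡ ∑ℕ n f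
∑-toℕ zero    f = refl
∑-toℕ (suc n) f = cong (λ y → f 0 + y) (∑-toℕ n (f ∘ suc))

∑ℕ-cong : ∀ n {f g : ℕ → ℤ} → (∀ k → k ℕ.< n → f k ≡ g k) → ∑ℕ n f ≡ ∑ℕ n g
∑ℕ-cong zero    f≗g = refl
∑ℕ-cong (suc n) f≗g = cong₂ _+_ (f≗g 0 (s≤s z≤n)) (∑ℕ-cong n λ k k<n → f≗g (suc k) (s≤s k<n))

∑ℕ-const : ∀ n {f : ℕ → ℤ} c → (∀ k → k ℕ.< n → f k ≡ c) → ∑ℕ n f ≡ + n * c
∑ℕ-const zero    c f≡c = ≡.sym (ℤP.*-zeroˡ c)
∑ℕ-const (suc n) {f} c f≡c = begin
  f 0 + ∑ℕ n (f ∘ suc)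
    ≡⟨ cong₂ _+_ (f≡c 0 (s≤s z≤n)) (∑ℕ-const n c λ k k<n → f≡c (suc k) (s≤s k<n)) ⟩
  c + + n * c
    ≡⟨ cong (_+ + n * c) (≡.sym (ℤP.*-identityˡ c)) ⟩
  1ℤ * c + + n * c
    ≡⟨ ≡.sym (ℤP.*-distribʳ-+ c 1ℤ (+ n)) ⟩
  + suc n * c ∎

∑ℕ-*ˡ : ∀ n c (f : ℕ → ℤ) → ∑ℕ n (λ k → c * f k) ≡ c * ∑ℕ n f
∑ℕ-*ˡ zero    c f = ≡.sym (ℤP.*-zeroʳ c)
∑ℕ-*ˡ (suc n) c f = trans (cong (λ y → c * f 0 + y) (∑ℕ-*ˡ n c (f ∘ suc)))
                          (≡.sym (ℤP.*-distribˡ-+ c (f 0) (∑ℕ n (f ∘ suc))))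

∑ℕ-around : ∀ {M n} (f : ℕ → ℤ) → M ℕ.< n →
  ∑ℕ n f ≡ ∑ℕ M f + f M + ∑ℕ (n ∸ suc M) (λ t → f (suc M ℕ.+ t))
∑ℕ-around {zero}  {suc n} f _ = cong (_+ ∑ℕ n (f ∘ suc)) (≡.sym (ℤP.+-identityˡ (f 0)))
∑ℕ-around {suc M} {suc n} f (s≤s M<n) = begin
  f 0 + ∑ℕ n (f ∘ suc)
    ≡⟨ cong (λ y → f 0 + y) (∑ℕ-around (f ∘ suc) M<n) ⟩
  f 0 + (∑ℕ M (f ∘ suc) + f (suc M) + R)
    ≡⟨ ≡.sym (ℤP.+-assoc (f 0) _ R) ⟩
  f 0 + (∑ℕ M (f ∘ suc) + f (suc M)) + R
    ≡⟨ cong (_+ R) (≡.sym (ℤP.+-assoc (f 0) _ (f (suc M)))) ⟩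
  f 0 + ∑ℕ M (f ∘ suc) + f (suc M) + R ∎
  where R = ∑ℕ (n ∸ suc M) (λ t → f (suc (suc M ℕ.+ t)))

count : ℕ → (ℕ → Bool) → ℕ
count zero    a = 0
count (suc n) a = (if a 0 then 1 else 0) ℕ.+ count n (a ∘ suc)

∑ℕ-b2ℤ : ∀ n (a : ℕ → Bool) → ∑ℕ n (b2ℤ ∘ a) ≡ + count n a
∑ℕ-b2ℤ zero    a = refl
∑ℕ-b2ℤ (suc n) a with a 0
... | true  = cong (λ y → 1ℤ + y) (∑ℕ-b2ℤ n (a ∘ suc))
... | false = trans (ℤP.+-identityˡ _) (∑ℕ-b2ℤ n (a ∘ suc))

count≤ : ∀ n a → count n a ≤ n
count≤ zero    a = z≤n
count≤ (suc n) a with a 0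
... | true  = s≤s (count≤ n (a ∘ suc))
... | false = ℕP.m≤n⇒m≤1+n (count≤ n (a ∘ suc))

count≡n : ∀ n a → count n a ≡ n → ∀ k → k ℕ.< n → a k ≡ true
count≡n (suc n) a c≡n k k<n with a 0 in a0
count≡n (suc n) a c≡n zero    _         | true  = a0
count≡n (suc n) a c≡n (suc k) (s≤s k<n) | true  = count≡n n (a ∘ suc) (ℕP.suc-injective c≡n) k k<n
... | false = contradiction (≡.subst (_≤ n) c≡n (count≤ n (a ∘ suc))) (ℕP.n≮n n)

count≡0 : ∀ n a → count n a ≡ 0 → ∀ k → k ℕ.< n → a k ≡ false
count≡0 (suc n) a c≡0 k k<n with a 0 in a0
count≡0 (suc n) a ()  k k<n | true
count≡0 (suc n) a c≡0 zero    _         | false = a0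
count≡0 (suc n) a c≡0 (suc k) (s≤s k<n) | false = count≡0 n (a ∘ suc) c≡0 k k<n

∑ℕ-b2ℤ-const : ∀ n (a : ℕ → Bool) b → ∑ℕ n (b2ℤ ∘ a) ≡ + n * b2ℤ b → ∀ k → k ℕ.< n → a k ≡ b
∑ℕ-b2ℤ-const n a true  ∑≡ = count≡n n a (ℤP.+-injective (trans (≡.sym (∑ℕ-b2ℤ n a)) (trans ∑≡ (ℤP.*-identityʳ (+ n)))))
∑ℕ-b2ℤ-const n a false ∑≡ = count≡0 n a (ℤP.+-injective (trans (≡.sym (∑ℕ-b2ℤ n a)) (trans ∑≡ (ℤP.*-zeroʳ (+ n)))))

-- The Laplacian and the vectors x_M

degMatrix-diag : ∀ {n} (G : SimpleGraph n) σ v → degMatrix G σ v v ≡ degree G (σ ⟨$⟩ʳ v)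
degMatrix-diag G σ v with v F.≟ v
... | yes _   = refl
... | no v≢v = contradiction refl v≢v

degMatrix-offdiag : ∀ {n} (G : SimpleGraph n) σ {v j} → j ≢ v → degMatrix G σ v j ≡ 0ℤ
degMatrix-offdiag G σ {v} {j} j≢v with v F.≟ j
... | yes v≡j = contradiction (≡.sym v≡j) j≢v
... | no _    = refl

degree-adjMatrix : ∀ {n} (G : SimpleGraph n) σ v → degree G (σ ⟨$⟩ʳ v) ≡ ∑ (adjMatrix G σ v)
degree-adjMatrix G σ v = ∑-permute (λ w → b2ℤ (adj G (σ ⟨$⟩ʳ v) w)) σ

laplacian-row : ∀ {n} (G : SimpleGraph n) σ (x : Vector n) v →
  (laplacian G σ · x) v ≡ ∑ (λ j → adjMatrix G σ v j * (x v - x j))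
laplacian-row G σ x v = begin
  ∑ (λ j → (D v j - A v j) * x j)
    ≡⟨ ∑-cong (λ j → [y-z]x≈yx-zx (x j) (D v j) (A v j)) ⟩
  ∑ (λ j → D v j * x j - A v j * x j)
    ≡⟨ ∑-sub (λ j → D v j * x j) (λ j → A v j * x j) ⟩
  ∑ (λ j → D v j * x j) - ∑ Ax
    ≡⟨ cong (_- ∑ Ax) (∑-single _ v λ j j≢v → trans (cong (_* x j) (degMatrix-offdiag G σ j≢v)) (ℤP.*-zeroˡ (x j))) ⟩
  D v v * x v - ∑ Ax
    ≡⟨ cong (λ d → d * x v - ∑ Ax) (trans (degMatrix-diag G σ v) (degree-adjMatrix G σ v)) ⟩
  ∑ (A v) * x v - ∑ Ax
    ≡⟨ cong (_- ∑ Ax) (≡.sym (∑-*ʳ (A v) (x v))) ⟩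
  ∑ (λ j → A v j * x v) - ∑ Ax
    ≡⟨ ≡.sym (∑-sub (λ j → A v j * x v) Ax) ⟩
  ∑ (λ j → A v j * x v - A v j * x j)
    ≡⟨ ∑-cong (λ j → ≡.sym (x[y-z]≈xy-xz (A v j) (x v) (x j))) ⟩
  ∑ (λ j → A v j * (x v - x j)) ∎
  where
  D = degMatrix G σ
  A = adjMatrix G σ
  Ax = λ j → A v j * x j

-- x_M for M ≥ 1 on ℕ indices; xℕ 0 is the zero vector, not x_0.
xℕ : ℕ → ℕ → ℤ
xℕ M k with k ℕ.<? M | k ℕ.≟ M
... | yes _ | _     = -1ℤ
... | no _  | yes _ = + M
... | no _  | no _  = 0ℤ

xvec-suc : ∀ {n} (i : Fin n) k → xvec (suc i) k ≡ xℕ (toℕ (suc i)) (toℕ k)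
xvec-suc i k with toℕ k ℕ.<? toℕ (suc i) | toℕ k ℕ.≟ toℕ (suc i)
... | yes _ | _     = refl
... | no _  | yes _ = refl
... | no _  | no _  = refl

xℕ-< : ∀ {M k} → k ℕ.< M → xℕ M k ≡ -1ℤ
xℕ-< {M} {k} k<M with k ℕ.<? M
... | yes _   = refl
... | no k≮M = contradiction k<M k≮M

xℕ-≡ : ∀ M → xℕ M M ≡ + M
xℕ-≡ M with M ℕ.<? M | M ℕ.≟ M
... | yes M<M | _       = contradiction M<M (ℕP.n≮n M)
... | no _    | yes _   = refl
... | no _    | no M≢M = contradiction refl M≢M

xℕ-> : ∀ {M k} → M ℕ.< k → xℕ M k ≡ 0ℤ
xℕ-> {M} {k} M<k with k ℕ.<? M | k ℕ.≟ M
... | yes k<M | _       = contradiction k<M (ℕP.<⇒≯ M<k)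
... | no _    | yes k≡M = contradiction (≡.sym k≡M) (ℕP.<⇒≢ M<k)
... | no _    | no _    = refl

-- c stands for x_M(v), the entry at the row's own vertex.
∑ℕ-row : ∀ {M n} c (a : ℕ → ℤ) → M ℕ.< n →
  ∑ℕ n (λ k → a k * (c - xℕ M k))
    ≡ (c + 1ℤ) * ∑ℕ M a + (c - + M) * a M + c * ∑ℕ (n ∸ suc M) (λ t → a (suc M ℕ.+ t))
∑ℕ-row {M} {n} c a M<n = begin
  ∑ℕ n f
    ≡⟨ ∑ℕ-around f M<n ⟩
  ∑ℕ M f + f M + ∑ℕ (n ∸ suc M) (λ t → f (suc M ℕ.+ t))
    ≡⟨ cong₂ _+_ (cong₂ _+_ before at) after ⟩
  (c + 1ℤ) * ∑ℕ M a + (c - + M) * a M + c * ∑ℕ (n ∸ suc M) (λ t → a (suc M ℕ.+ t)) ∎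
  where
  f = λ k → a k * (c - xℕ M k)
  before : ∑ℕ M f ≡ (c + 1ℤ) * ∑ℕ M a
  before = trans (∑ℕ-cong M λ k k<M → trans (cong (λ y → a k * (c - y)) (xℕ-< k<M)) (ℤP.*-comm (a k) (c + 1ℤ)))
                 (∑ℕ-*ˡ M (c + 1ℤ) a)
  at : f M ≡ (c - + M) * a M
  at = trans (cong (λ y → a M * (c - y)) (xℕ-≡ M)) (ℤP.*-comm (a M) (c - + M))
  after : ∑ℕ (n ∸ suc M) (λ t → f (suc M ℕ.+ t)) ≡ c * ∑ℕ (n ∸ suc M) (λ t → a (suc M ℕ.+ t))
  after = trans (∑ℕ-cong (n ∸ suc M) λ t _ →
                   trans (cong (λ y → a (suc M ℕ.+ t) * (c - y)) (xℕ-> (s≤s (ℕP.m≤m+n M t))))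
                         (trans (cong (a (suc M ℕ.+ t) *_) (ℤP.+-identityʳ c)) (ℤP.*-comm (a (suc M ℕ.+ t)) c)))
                (∑ℕ-*ˡ (n ∸ suc M) c (λ t → a (suc M ℕ.+ t)))

row-constant-below : ∀ (a : ℕ → Bool) {M n v} → M ℕ.< n → M ℕ.< v →
  ∑ℕ n (λ k → b2ℤ (a k) * (xℕ M v - xℕ M k)) ≡ 0ℤ → ∀ k → k ℕ.< M → a k ≡ a M
row-constant-below a {M} {n} M<n M<v row≡0 rewrite xℕ-> M<v = ∑ℕ-b2ℤ-const M a (a M) (begin
  ∑ℕ M (b2ℤ ∘ a)
    ≡⟨ isolate (∑ℕ M (b2ℤ ∘ a)) (+ M) (b2ℤ (a M)) D ⟩
  (0ℤ + 1ℤ) * ∑ℕ M (b2ℤ ∘ a) + (0ℤ - + M) * b2ℤ (a M) + 0ℤ * D + + M * b2ℤ (a M)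
    ≡⟨ cong (_+ + M * b2ℤ (a M)) (trans (≡.sym (∑ℕ-row 0ℤ (b2ℤ ∘ a) M<n)) row≡0) ⟩
  0ℤ + + M * b2ℤ (a M)
    ≡⟨ ℤP.+-identityˡ _ ⟩
  + M * b2ℤ (a M) ∎)
  where
  D = ∑ℕ (n ∸ suc M) (λ t → b2ℤ (a (suc M ℕ.+ t)))
  isolate : ∀ A m b D → A ≡ (0ℤ + 1ℤ) * A + (0ℤ - m) * b + 0ℤ * D + m * b
  isolate = solve-∀

-- Threshold graphs

thresholdAdj : (ℕ → Bool) → ℕ → ℕ → Bool
thresholdAdj s v k with ℕP.<-cmp v k
... | tri< _ _ _ = s k
... | tri≈ _ _ _ = false
... | tri> _ _ _ = s v

thresholdAdj-< : ∀ s {v k} → v ℕ.< k → thresholdAdj s v k ≡ s k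
thresholdAdj-< s {v} {k} v<k with ℕP.<-cmp v k
... | tri< _ _ _     = refl
... | tri≈ v≮k _ _   = contradiction v<k v≮k
... | tri> v≮k _ _   = contradiction v<k v≮k

thresholdAdj-> : ∀ s {v k} → k ℕ.< v → thresholdAdj s v k ≡ s v
thresholdAdj-> s {v} {k} k<v with ℕP.<-cmp v k
... | tri< _ _ k≮v = contradiction k<v k≮v
... | tri≈ _ _ k≮v = contradiction k<v k≮v
... | tri> _ _ _   = refl

thresholdAdj⇔ : ∀ s i j →
  thresholdAdj s i j ≡ true ⇔ ((i ℕ.< j × s j ≡ true) ⊎ (j ℕ.< i × s i ≡ true))
thresholdAdj⇔ s i j with ℕP.<-cmp i j
... | tri< i<j _ j≮i = mk⇔ (λ sj → inj₁ (i<j , sj)) λ where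
  (inj₁ (_ , sj))  → sj
  (inj₂ (j<i , _)) → contradiction j<i j≮i
... | tri≈ i≮j _ j≮i = mk⇔ (λ ()) λ where
  (inj₁ (i<j , _)) → contradiction i<j i≮j
  (inj₂ (j<i , _)) → contradiction j<i j≮i
... | tri> i≮j _ j<i = mk⇔ (λ si → inj₂ (j<i , si)) λ where
  (inj₁ (i<j , _)) → contradiction i<j i≮j
  (inj₂ (_ , si))  → si

thresholdEigenvalue : (ℕ → Bool) → ℕ → ℕ → ℤ
thresholdEigenvalue s n M = b2ℤ (s M) * + suc M + ∑ℕ (n ∸ suc M) (λ t → b2ℤ (s (suc M ℕ.+ t)))

threshold-row-< : ∀ s {M n v} → M ℕ.< n → v ℕ.< M →
  ∑ℕ n (λ k → b2ℤ (thresholdAdj s v k) * (-1ℤ - xℕ M k)) ≡ thresholdEigenvalue s n M * -1ℤ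
threshold-row-< s {M} {n} {v} M<n v<M = begin
  _ ≡⟨ ∑ℕ-row -1ℤ a M<n ⟩
  (-1ℤ + 1ℤ) * ∑ℕ M a + (-1ℤ - + M) * a M + -1ℤ * ∑ℕ r (a ∘ (suc M ℕ.+_))
    ≡⟨ cong₂ (λ b R → (-1ℤ + 1ℤ) * ∑ℕ M a + (-1ℤ - + M) * b + -1ℤ * R)
             (cong b2ℤ (thresholdAdj-< s v<M))
             (∑ℕ-cong r λ t _ → cong b2ℤ (thresholdAdj-< s (ℕP.<-trans v<M (s≤s (ℕP.m≤m+n M t))))) ⟩
  (-1ℤ + 1ℤ) * ∑ℕ M a + (-1ℤ - + M) * b2ℤ (s M) + -1ℤ * D
    ≡⟨ identity (∑ℕ M a) (+ M) (b2ℤ (s M)) D ⟩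
  thresholdEigenvalue s n M * -1ℤ ∎
  where
  a = b2ℤ ∘ thresholdAdj s v
  r = n ∸ suc M
  D = ∑ℕ r (λ t → b2ℤ (s (suc M ℕ.+ t)))
  identity : ∀ A m b D → (-1ℤ + 1ℤ) * A + (-1ℤ - m) * b + -1ℤ * D ≡ (b * (1ℤ + m) + D) * -1ℤ
  identity = solve-∀

threshold-row-≡ : ∀ s {M n} → M ℕ.< n →
  ∑ℕ n (λ k → b2ℤ (thresholdAdj s M k) * (+ M - xℕ M k)) ≡ thresholdEigenvalue s n M * + M
threshold-row-≡ s {M} {n} M<n = begin
  _ ≡⟨ ∑ℕ-row (+ M) a M<n ⟩
  (+ M + 1ℤ) * ∑ℕ M a + (+ M - + M) * a M + + M * ∑ℕ r (a ∘ (suc M ℕ.+_))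
    ≡⟨ cong₂ (λ A R → (+ M + 1ℤ) * A + (+ M - + M) * a M + + M * R)
             (∑ℕ-const M (b2ℤ (s M)) λ k k<M → cong b2ℤ (thresholdAdj-> s k<M))
             (∑ℕ-cong r λ t _ → cong b2ℤ (thresholdAdj-< s (s≤s (ℕP.m≤m+n M t)))) ⟩
  (+ M + 1ℤ) * (+ M * b2ℤ (s M)) + (+ M - + M) * a M + + M * D
    ≡⟨ identity (+ M) (b2ℤ (s M)) (a M) D ⟩
  thresholdEigenvalue s n M * + M ∎
  where
  a = b2ℤ ∘ thresholdAdj s M
  r = n ∸ suc M
  D = ∑ℕ r (λ t → b2ℤ (s (suc M ℕ.+ t)))
  identity : ∀ m b c D → (m + 1ℤ) * (m * b) + (m - m) * c + m * D ≡ (b * (1ℤ + m) + D) * m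
  identity = solve-∀

threshold-row-> : ∀ s {M n v} → M ℕ.< n → M ℕ.< v →
  ∑ℕ n (λ k → b2ℤ (thresholdAdj s v k) * (0ℤ - xℕ M k)) ≡ 0ℤ
threshold-row-> s {M} {n} {v} M<n M<v = begin
  _ ≡⟨ ∑ℕ-row 0ℤ a M<n ⟩
  (0ℤ + 1ℤ) * ∑ℕ M a + (0ℤ - + M) * a M + 0ℤ * D
    ≡⟨ cong₂ (λ A b → (0ℤ + 1ℤ) * A + (0ℤ - + M) * b + 0ℤ * D)
             (∑ℕ-const M (b2ℤ (s v)) λ k k<M → cong b2ℤ (thresholdAdj-> s (ℕP.<-trans k<M M<v)))
             (cong b2ℤ (thresholdAdj-> s M<v)) ⟩
  (0ℤ + 1ℤ) * (+ M * b2ℤ (s v)) + (0ℤ - + M) * b2ℤ (s v) + 0ℤ * D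
    ≡⟨ identity (+ M) (b2ℤ (s v)) D ⟩
  0ℤ ∎
  where
  a = b2ℤ ∘ thresholdAdj s v
  D = ∑ℕ (n ∸ suc M) (a ∘ (suc M ℕ.+_))
  identity : ∀ m b D → (0ℤ + 1ℤ) * (m * b) + (0ℤ - m) * b + 0ℤ * D ≡ 0ℤ
  identity = solve-∀

threshold-row : ∀ s {M n} v → M ℕ.< n →
  ∑ℕ n (λ k → b2ℤ (thresholdAdj s v k) * (xℕ M v - xℕ M k)) ≡ thresholdEigenvalue s n M * xℕ M v
threshold-row s {M} {n} v M<n with ℕP.<-cmp v M
... | tri< v<M _ _ rewrite xℕ-< v<M = threshold-row-< s M<n v<M
... | tri≈ _ refl _ rewrite xℕ-≡ M = threshold-row-≡ s M<n
... | tri> _ _ M<v rewrite xℕ-> M<v = trans (threshold-row-> s M<n M<v) (≡.sym (ℤP.*-zeroʳ (thresholdEigenvalue s n M)))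

-- Labellings

extend : ∀ {n} {A : Set} → (Fin n → A) → A → ℕ → A
extend {zero}  g d _       = d
extend {suc n} g d zero    = g zero
extend {suc n} g d (suc k) = extend (g ∘ suc) d k

extend-toℕ : ∀ {n} {A : Set} (g : Fin n → A) d j → extend g d (toℕ j) ≡ g j
extend-toℕ g d zero    = refl
extend-toℕ g d (suc j) = extend-toℕ (g ∘ suc) d j

IsThresholdLabelling : ∀ {n} → SimpleGraph n → Permutation′ n → (Fin n → Bool) → Set
IsThresholdLabelling G σ s =
  ∀ i j → adj G (σ ⟨$⟩ʳ i) (σ ⟨$⟩ʳ j) ≡ thresholdAdj (extend s false) (toℕ i) (toℕ j)

thresholdAdj-extend⇔ : ∀ {n} (s : Fin n → Bool) i j →
  thresholdAdj (extend s false) (toℕ i) (toℕ j) ≡ true ⇔ ((i F.< j × s j ≡ true) ⊎ (j F.< i × s i ≡ true))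
thresholdAdj-extend⇔ s i j =
  ⇔.trans (thresholdAdj⇔ _ (toℕ i) (toℕ j)) ((⇔.refl ×-⇔ extended j) ⊎-⇔ (⇔.refl ×-⇔ extended i))
  where
  extended : ∀ k → extend s false (toℕ k) ≡ true ⇔ s k ≡ true
  extended k = mk⇔ (trans (≡.sym (extend-toℕ s false k))) (trans (extend-toℕ s false k))

IsThreshold⇔labelling : ∀ {n} (G : SimpleGraph n) →
  IsThreshold G ⇔ Σ (Permutation′ n) λ σ → Σ (Fin n → Bool) (IsThresholdLabelling G σ)
IsThreshold⇔labelling G = mk⇔
  (λ (σ , s , adj⇔) → σ , s , λ i j → ⇔→≡ (⇔.trans (adj⇔ i j) (⇔.sym (thresholdAdj-extend⇔ s i j))))
  (λ (σ , s , adj≡) → σ , s , λ i j → ⇔.trans (≡-true⇔ (adj≡ i j)) (thresholdAdj-extend⇔ s i j))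
  where
  ≡-true⇔ : ∀ {a b} → a ≡ b → a ≡ true ⇔ b ≡ true
  ≡-true⇔ a≡b = mk⇔ (trans (≡.sym a≡b)) (trans a≡b)

-- Matching on the comparison that defines thresholdAdj makes the right-hand sides compute.
adj-earlier⇒IsThresholdLabelling : ∀ {n} (G : SimpleGraph n) σ (s : Fin n → Bool) →
  (∀ v w → toℕ w ℕ.< toℕ v → adj G (σ ⟨$⟩ʳ v) (σ ⟨$⟩ʳ w) ≡ s v) → IsThresholdLabelling G σ s
adj-earlier⇒IsThresholdLabelling G σ s earlier i j with ℕP.<-cmp (toℕ i) (toℕ j)
... | tri< i<j _ _ = trans (SimpleGraph.sym G _ _) (trans (earlier j i i<j) (≡.sym (extend-toℕ s false j)))
... | tri≈ _ i≡j _ rewrite FP.toℕ-injective i≡j = irrefl G _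
... | tri> _ _ j<i = trans (earlier i j j<i) (≡.sym (extend-toℕ s false i))

laplacian-row-ℕ : ∀ {n} (G : SimpleGraph n) σ (x : Vector n) v (a : ℕ → Bool) (y : ℕ → ℤ) →
  (∀ j → adj G (σ ⟨$⟩ʳ v) (σ ⟨$⟩ʳ j) ≡ a (toℕ j)) → (∀ j → x j ≡ y (toℕ j)) →
  (laplacian G σ · x) v ≡ ∑ℕ n (λ k → b2ℤ (a k) * (y (toℕ v) - y k))
laplacian-row-ℕ {n} G σ x v a y adj≡ x≡ = begin
  (laplacian G σ · x) v
    ≡⟨ laplacian-row G σ x v ⟩
  ∑ {n} (λ j → adjMatrix G σ v j * (x v - x j))
    ≡⟨ ∑-cong (λ j → cong₂ _*_ (cong b2ℤ (adj≡ j)) (cong₂ _-_ (x≡ v) (x≡ j))) ⟩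
  ∑ {n} (f ∘ toℕ)
    ≡⟨ ∑-toℕ n f ⟩
  ∑ℕ n f ∎
  where f = λ k → b2ℤ (a k) * (y (toℕ v) - y k)

xvec-suc-≢0 : ∀ {n} (i : Fin n) → xvec (suc i) (suc i) ≢ 0ℤ
xvec-suc-≢0 i x≡0 with trans (≡.sym (trans (xvec-suc i (suc i)) (xℕ-≡ (toℕ (suc i))))) x≡0
... | ()

threshold-eigenvectors : ∀ {n} (G : SimpleGraph n) σ s → IsThresholdLabelling G σ s →
  ∀ i → IsEigenvector (laplacian G σ) (xvec i)
threshold-eigenvectors G σ s _ zero = (zero , λ ()) , 0ℤ , λ v →
  trans (laplacian-row G σ (xvec zero) v) (trans (∑-*ʳ (adjMatrix G σ v) 0ℤ) (ℤP.*-zeroʳ (∑ (adjMatrix G σ v))))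
threshold-eigenvectors {n} G σ s adj≡ (suc i) = (suc i , xvec-suc-≢0 i) , λ′ , λ v → begin
  (laplacian G σ · xvec (suc i)) v
    ≡⟨ laplacian-row-ℕ G σ (xvec (suc i)) v (thresholdAdj s′ (toℕ v)) (xℕ M) (adj≡ v) (xvec-suc i) ⟩
  ∑ℕ n (λ k → b2ℤ (thresholdAdj s′ (toℕ v) k) * (xℕ M (toℕ v) - xℕ M k))
    ≡⟨ threshold-row s′ (toℕ v) (FP.toℕ<n (suc i)) ⟩
  λ′ * xℕ M (toℕ v)
    ≡⟨ cong (λ′ *_) (≡.sym (xvec-suc i v)) ⟩
  λ′ * xvec (suc i) v ∎
  where
  s′ = extend s false
  M = toℕ (suc i)
  λ′ = thresholdEigenvalue s′ n M

eigenvector-row-constant : ∀ {n} (G : SimpleGraph (suc n)) σ (i : Fin n) →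
  IsEigenvector (laplacian G σ) (xvec (suc i)) →
  ∀ v w → toℕ (suc i) ℕ.< toℕ v → toℕ w ℕ.< toℕ (suc i) →
  adj G (σ ⟨$⟩ʳ v) (σ ⟨$⟩ʳ w) ≡ adj G (σ ⟨$⟩ʳ v) (σ ⟨$⟩ʳ suc i)
eigenvector-row-constant {n} G σ i (_ , λ′ , eig) v w M<v w<M = begin
  row w           ≡⟨ ≡.sym (extend-toℕ row false w) ⟩
  a (toℕ w)       ≡⟨ row-constant-below a (FP.toℕ<n (suc i)) M<v row≡0 (toℕ w) w<M ⟩
  a M             ≡⟨ extend-toℕ row false (suc i) ⟩
  row (suc i)     ∎
  where
  row = λ j → adj G (σ ⟨$⟩ʳ v) (σ ⟨$⟩ʳ j)
  a = extend row false
  M = toℕ (suc i)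
  row≡0 : ∑ℕ (suc n) (λ k → b2ℤ (a k) * (xℕ M (toℕ v) - xℕ M k)) ≡ 0ℤ
  row≡0 = begin
    _ ≡⟨ ≡.sym (laplacian-row-ℕ G σ (xvec (suc i)) v a (xℕ M) (λ j → ≡.sym (extend-toℕ row false j)) (xvec-suc i)) ⟩
    (laplacian G σ · xvec (suc i)) v ≡⟨ eig v ⟩
    λ′ * xvec (suc i) v               ≡⟨ cong (λ′ *_) (trans (xvec-suc i v) (xℕ-> M<v)) ⟩
    λ′ * 0ℤ                           ≡⟨ ℤP.*-zeroʳ λ′ ⟩
    0ℤ                                ∎

eigenvectors-adj-earlier : ∀ {n} (G : SimpleGraph (suc n)) σ →
  (∀ i → IsEigenvector (laplacian G σ) (xvec i)) →
  ∀ v w → toℕ w ℕ.< toℕ v → adj G (σ ⟨$⟩ʳ v) (σ ⟨$⟩ʳ w) ≡ adj G (σ ⟨$⟩ʳ v) (σ ⟨$⟩ʳ zero)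
eigenvectors-adj-earlier G σ eig v zero    _   = refl
eigenvectors-adj-earlier G σ eig v (suc w) w<v =
  ≡.sym (eigenvector-row-constant G σ w (eig (suc w)) v zero w<v (s≤s z≤n))

theorem3p3 : (n : ℕ) → 2 ≤ n → (G : SimpleGraph n) →
    (Σ (Permutation′ n) (λ σ → (i : Fin n) → IsEigenvector (laplacian G σ) (xvec i)))
      ⇔ IsThreshold G
theorem3p3 zero    ()
theorem3p3 (suc n) _ G = mk⇔
  (λ (σ , eig) → from (σ , _ , adj-earlier⇒IsThresholdLabelling G σ _ (eigenvectors-adj-earlier G σ eig)))
  (λ threshold → let (σ , s , adj≡) = to threshold in σ , threshold-eigenvectors G σ s adj≡)
  where open Equivalence (IsThreshold⇔labelling G)
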